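{- Let $\vdash$ be a substitution-invariant multiset deductive relation on a propositional language $\mathcal{L}$. Then ${\vdash}={\models_{\mathbf{Mod}(\vdash)}}={\models'_{\mathbf{Mod}(\vdash)}}$.
   Context: Finite multisets over a set $X$ form $X^\flat$, with sub-multiset order $\leqslant$, sum $\uplus$; homomorphisms extend elementwise to multisets. A multiset deductive relation (MDR) on $\mathcal{L}$ is a relation $\vdash$ on $Fm_{\mathcal{L}}^\flat$ with $\Gamma\uplus\Delta\vdash\Gamma$; $\Gamma\vdash\Delta\Rightarrow\Gamma\uplus\Pi\vdash\Delta\uplus\Pi$; $\Gamma\vdash\Delta,\Delta\vdash\Pi\Rightarrow\Gamma\vdash\Pi$; substitution-invariant if $\Gamma\vdash\Delta$ implies $\sigma(\Gamma)\vdash\sigma(\Delta)$ for all substitutions $\sigma$. An $\mathcal{L}$-hypermatrix is $\langle\mathbf{A},F\rangle$ with $\mathbf{A}$ an $\mathcal{L}$-algebra and $F$ a $\leqslant$-downset of $A^\flat$. For a class $\mathsf{H}$ of hypermatrices: $\Gamma\models_{\mathsf{H}}\Delta$ iff for all $\langle\mathbf{A},F\rangle\in\mathsf{H}$, all $\mathfrak{C}\in A^\flat$ and all homomorphisms $f\colon\mathbf{Fm}_{\mathcal{L}}\to\mathbf{A}$, $\mathfrak{C}\uplus f(\Gamma)\in F$ implies $\mathfrak{C}\uplus f(\Delta)\in F$; $\Gamma\models'_{\mathsf{H}}\Delta$ iff for all $\langle\mathbf{A},F\rangle\in\mathsf{H}$ and all homomorphisms $f$, $f(\Gamma)\in F$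 implies $f(\Delta)\in F$. $\mathbf{Mod}(\vdash)$ is the class of hypermatrices $\langle\mathbf{A},F\rangle$ with ${\vdash}\subseteq{\models_{\{\langle\mathbf{A},F\rangle\}}}$. -}

module Defs where

open import Level using (Level; _⊔_) renaming (suc to lsuc; zero to lzero)
open import Data.Nat using (ℕ)
open import Data.Fin using (Fin)
open import Data.List using (List; []; _++_; map)
open import Data.List.Relation.Binary.Permutation.Propositional using (_↭_)
open import Data.Product using (Σ; ∃; _×_; _,_)
open import Relation.Binary.PropositionalEquality using (_≡_)
open import Function using (_∘_)

record Language : Set₁ where
  field
    Op    : Set
    arity : Op → ℕ
open Language public

data Fm (L : Language) : Set where
  var : ℕ → Fm L
  op  : (o : Op L) → (Fin (arity L o) → Fm L) → Fm L

record Algebra (L : Language) : Set₁ where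
  field
    Carrier : Set
    ⟦_⟧     : (o : Op L) → (Fin (arity L o) → Carrier) → Carrier
open Algebra public

FmAlg : (L : Language) → Algebra L
FmAlg L = record { Carrier = Fm L ; ⟦_⟧ = op }

IsHom : {L : Language} (A B : Algebra L) → (Carrier A → Carrier B) → Set
IsHom {L} A B f = ∀ (o : Op L) (as : Fin (arity L o) → Carrier A) →
  f (⟦_⟧ A o as) ≡ ⟦_⟧ B o (f ∘ as)

Hom : {L : Language} (A : Algebra L) → Set
Hom {L} A = Σ (Fm L → Carrier A) (IsHom (FmAlg L) A)

Subst : Language → Set
Subst L = Hom (FmAlg L)

-- Finite multisets over X are represented by lists up to permutation (↭).
-- Multiset sum ⊎ is _++_; homomorphisms act elementwise via map.

_≤ₘ_ : {X : Set} → List X → List X → Set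
Γ ≤ₘ Δ = ∃ λ Π → Δ ↭ (Γ ++ Π)

-- A multiset deductive relation (MDR) on L.  Since multisets are lists
-- modulo ↭, the relation must be well defined on ↭-classes.
record IsMDR {L : Language} (_⊢_ : List (Fm L) → List (Fm L) → Set) : Set where
  field
    well-defined : ∀ {Γ Γ' Δ Δ'} → Γ ↭ Γ' → Δ ↭ Δ' → Γ ⊢ Δ → Γ' ⊢ Δ'
    weakening    : ∀ Γ Δ → (Γ ++ Δ) ⊢ Γ
    context      : ∀ {Γ Δ} Π → Γ ⊢ Δ → (Γ ++ Π) ⊢ (Δ ++ Π)
    cut          : ∀ {Γ Δ Π} → Γ ⊢ Δ → Δ ⊢ Π → Γ ⊢ Π

SubstInvariant : {L : Language} → (List (Fm L) → List (Fm L) → Set) → Set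
SubstInvariant {L} _⊢_ = ∀ {Γ Δ} (σ : Subst L) →
  Γ ⊢ Δ → map (Data.Product.proj₁ σ) Γ ⊢ map (Data.Product.proj₁ σ) Δ

record Hypermatrix (L : Language) : Set₁ where
  field
    alg      : Algebra L
    F        : List (Carrier alg) → Set
    downset  : ∀ {Γ Δ} → Γ ≤ₘ Δ → F Δ → F Γ
open Hypermatrix public

HClass : Language → Set₁
HClass L = Hypermatrix L → Set

_⊨[_]_ : {L : Language} → List (Fm L) → HClass L → List (Fm L) → Set₁
_⊨[_]_ {L} Γ H Δ = ∀ (M : Hypermatrix L) → H M →
  ∀ (C : List (Carrier (alg M))) (f : Hom (alg M)) →
  F M (C ++ map (Data.Product.proj₁ f) Γ) → F M (C ++ map (Data.Product.proj₁ f) Δ)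

_⊨'[_]_ : {L : Language} → List (Fm L) → HClass L → List (Fm L) → Set₁
_⊨'[_]_ {L} Γ H Δ = ∀ (M : Hypermatrix L) → H M →
  ∀ (f : Hom (alg M)) →
  F M (map (Data.Product.proj₁ f) Γ) → F M (map (Data.Product.proj₁ f) Δ)

Mod : {L : Language} → (List (Fm L) → List (Fm L) → Set) → HClass L
Mod {L} _⊢_ M = ∀ {Γ Δ} → Γ ⊢ Δ →
  ∀ (C : List (Carrier (alg M))) (f : Hom (alg M)) →
  F M (C ++ map (Data.Product.proj₁ f) Γ) → F M (C ++ map (Data.Product.proj₁ f) Δ)

module Submission where

-- For each Γ, the "theory hypermatrix" ⟨Fm_L, {Δ | Γ ⊢ Δ}⟩ is a model of ⊢: it is a downset by
-- weakening and cut, and it validates ⊢ under every context and substitution by substitution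
-- invariance and the context rule.  Evaluating Γ ⊨'_Mod Δ in it at the identity substitution,
-- where Γ ⊢ Γ holds, yields Γ ⊢ Δ.

open import Defs
open import Data.List using (List; []; _++_; map)
open import Data.List.Properties using (map-id; ++-identityʳ)
open import Data.List.Relation.Binary.Permutation.Propositional using (_↭_; ↭-refl; ↭-sym; ↭-reflexive)
open import Data.List.Relation.Binary.Permutation.Propositional.Properties using (++-comm)
open import Data.Product using (_×_; _,_; proj₁)
open import Function using (id; _∘′_)
open import Function.Bundles using (_⇔_; mk⇔)
open import Relation.Binary.PropositionalEquality using (refl; subst; sym)

≤ₘ-refl : {X : Set} (Γ : List X) → Γ ≤ₘ Γ
≤ₘ-refl Γ = [] , ↭-sym (↭-reflexive (++-identityʳ Γ))

idHom : {L : Language} → Subst L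
idHom = id , λ o as → refl

module MDRProperties {L : Language} {_⊢_ : List (Fm L) → List (Fm L) → Set}
                     (mdr : IsMDR _⊢_) where
  open IsMDR mdr

  ≤ₘ⇒⊢ : ∀ {Γ Δ} → Δ ≤ₘ Γ → Γ ⊢ Δ
  ≤ₘ⇒⊢ {Γ} {Δ} (Π , Γ↭Δ++Π) = well-defined (↭-sym Γ↭Δ++Π) ↭-refl (weakening Δ Π)

  ⊢-refl : ∀ Γ → Γ ⊢ Γ
  ⊢-refl Γ = ≤ₘ⇒⊢ (≤ₘ-refl Γ)

  context-left : ∀ {Γ Δ} C → Γ ⊢ Δ → (C ++ Γ) ⊢ (C ++ Δ)
  context-left {Γ} {Δ} C Γ⊢Δ = well-defined (++-comm Γ C) (++-comm Δ C) (context C Γ⊢Δ)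

  theoryHypermatrix : List (Fm L) → Hypermatrix L
  theoryHypermatrix Γ = record
    { alg     = FmAlg L
    ; F       = Γ ⊢_
    ; downset = λ Δ≤Π Γ⊢Π → cut Γ⊢Π (≤ₘ⇒⊢ Δ≤Π)
    }

  theoryHypermatrix-∈-Mod : SubstInvariant _⊢_ → ∀ Γ → Mod _⊢_ (theoryHypermatrix Γ)
  theoryHypermatrix-∈-Mod si Γ Δ⊢Π C σ Γ⊢CΔ = cut Γ⊢CΔ (context-left C (si σ Δ⊢Π))

  ⊨'Mod⇒⊢ : SubstInvariant _⊢_ → ∀ {Γ Δ} → Γ ⊨'[ Mod _⊢_ ] Δ → Γ ⊢ Δ
  ⊨'Mod⇒⊢ si {Γ} {Δ} Γ⊨'Δ =
    subst (Γ ⊢_) (map-id Δ)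
      (Γ⊨'Δ (theoryHypermatrix Γ) (theoryHypermatrix-∈-Mod si Γ) idHom
        (subst (Γ ⊢_) (sym (map-id Γ)) (⊢-refl Γ)))

⊢⇒⊨Mod : {L : Language} {_⊢_ : List (Fm L) → List (Fm L) → Set} →
         ∀ {Γ Δ} → Γ ⊢ Δ → Γ ⊨[ Mod _⊢_ ] Δ
⊢⇒⊨Mod Γ⊢Δ M M∈Mod = M∈Mod Γ⊢Δ

⊨⇒⊨' : {L : Language} {H : HClass L} → ∀ {Γ Δ} → Γ ⊨[ H ] Δ → Γ ⊨'[ H ] Δ
⊨⇒⊨' Γ⊨Δ M M∈H = Γ⊨Δ M M∈H []

theorem5p12 : (L : Language) (_⊢_ : List (Fm L) → List (Fm L) → Set) →
    IsMDR _⊢_ → SubstInvariant _⊢_ →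
    ∀ (Γ Δ : List (Fm L)) →
      ((Γ ⊢ Δ) ⇔ (Γ ⊨[ Mod _⊢_ ] Δ)) × ((Γ ⊨[ Mod _⊢_ ] Δ) ⇔ (Γ ⊨'[ Mod _⊢_ ] Δ))
theorem5p12 L _⊢_ mdr si Γ Δ =
  mk⇔ ⊢⇒⊨Mod (⊨'Mod⇒⊢ si ∘′ ⊨⇒⊨') , mk⇔ ⊨⇒⊨' (⊢⇒⊨Mod ∘′ ⊨'Mod⇒⊢ si)
  where open MDRProperties mdr
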